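{- Let $A$ be a set of vertices of the $n$-cycle $C_n$ with $2\leq |A|=m\leq n$. Then the set returned by Ascending Local Search$(C_n,W,A)$ is a maximizer of $W$, i.e. it has cardinality $m$ and the largest value of $W$ among all $m$-element vertex sets of $C_n$.
   Context: $C_n$ has vertices $0,\ldots,n-1$ with $u$ adjacent to $u\pm1 \bmod n$; $d$ is the graph distance, $W(X)=\sum_{\{u,v\}\subseteq X,\,u\neq v}d(u,v)$. A perturbation of $X$ is $(X\setminus\{u\})\cup\{v\}$ with $u\in X$, $v\notin X$, $\{u,v\}$ an edge. Ascending Local Search$(G,F,A)$: set $X=A$; let $L$ be the list of all perturbations of $X$; if $F(L(i))>F(X)$ for some $i$, replace $X$ by $L(j)$ for the least such $j$ and repeat; otherwise return $X$. -}

module Defs where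

open import Data.Nat using (ℕ; zero; suc; _+_; _∸_; _⊓_; _≤_; _<_; ∣_-_∣; _%_)
open import Data.Nat.DivMod using (m%n<n)
open import Data.Bool using (Bool; true; false; if_then_else_; _∧_)
open import Data.Fin using (Fin; toℕ; fromℕ<; _<?_)
open import Data.Fin.Subset using (Subset)
open import Data.Vec using (lookup; _[_]≔_)
open import Data.List using (List; []; _∷_; _++_; map; allFin; concatMap)
open import Data.Nat.ListAction using (sum)
open import Data.List.Relation.Unary.All using (All)
open import Relation.Binary.PropositionalEquality using (_≡_)
open import Relation.Nullary.Decidable using (⌊_⌋)

-- Neighbours u+1 mod n and u-1 mod n.
next : ∀ {n} → Fin n → Fin n
next {suc k} u = fromℕ< (m%n<n (suc (toℕ u)) (suc k))

prev : ∀ {n} → Fin n → Fin n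
prev {suc k} u = fromℕ< (m%n<n (toℕ u + k) (suc k))

-- Graph distance in C_n (closed form of the shortest-path distance).
dist : ∀ {n} → Fin n → Fin n → ℕ
dist {n} u v = ∣ toℕ u - toℕ v ∣ ⊓ (n ∸ ∣ toℕ u - toℕ v ∣)

W : ∀ {n} → Subset n → ℕ
W {n} X = sum (map (λ u → sum (map (λ v →
            if lookup X u ∧ lookup X v ∧ ⌊ u <? v ⌋ then dist u v else 0)
          (allFin n))) (allFin n))

perturb : ∀ {n} → Subset n → Fin n → Fin n → Subset n
perturb X u v = (X [ u ]≔ false) [ v ]≔ true

perturbations : ∀ {n} → Subset n → List (Subset n)
perturbations {n} X = concatMap (λ u →
    if lookup X u
    then concatMap (λ v → if lookup X v then [] else perturb X u v ∷ [])
                   (next u ∷ prev u ∷ [])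
    else [])
  (allFin n)

-- ALS F X R : Ascending Local Search(C_n, F, X) returns R.
data ALS {n} (F : Subset n → ℕ) : Subset n → Subset n → Set where
  stop : ∀ {X} → All (λ Y → F Y ≤ F X) (perturbations X) → ALS F X X
  step : ∀ {X Y R} (pre post : List (Subset n)) →
         perturbations X ≡ pre ++ (Y ∷ post) →
         All (λ Z → F Z ≤ F X) pre →
         F X < F Y →
         ALS F Y R → ALS F X R

module Submission where

-- Read X ⊆ C_n as a 0/1 sequence x of period n, put s = ⌈n/2⌉, r = ⌊n/2⌋, and let
-- window t = x t + … + x (t + s - 1) count the points of X on the half-cycle arc starting
-- at t.  An ordered pair of points at cyclic distance d has its first point on, and its
-- second point off, exactly d of the n arcs, hence 2 W(X) = Σ_t window t · (|X| - window t).
-- Moving a point of X to a free neighbour changes exactly two windows, r apart, one by -1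
-- and one by +1.  So at a local maximum no window differs from the window r further on by
-- 2 or more: such an imbalance would propagate around the whole cycle and force X to be
-- empty or full.  As window t + window (t + r) is |X| or |X| + 1, every window of a local
-- maximum then holds ⌊|X|/2⌋ or ⌊|X|/2⌋ + 1 points, which maximises every summand (for even
-- |X| after adding window t to the t-th summand, which adds the constant s · |X| to the
-- sum).  Finally, ascending local search strictly increases the bounded quantity W, so it
-- stops, and only at local maxima.

open import Defs
open import Data.Nat using (ℕ; _≤_)
open import Data.Fin.Subset using (Subset; ∣_∣)
open import Data.Product using (_×_; ∃)
open import Relation.Binary.PropositionalEquality using (_≡_)

open import Data.Bool using (Bool; true; false; if_then_else_; _∧_)
open import Data.Fin as F using (Fin; zero; suc; toℕ; fromℕ<)
open import Data.Fin.Properties using (toℕ-injective; toℕ-fromℕ<; toℕ<n)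
open import Data.Fin.Subset.Properties using (∣p∣≤n)
open import Data.List using (List; []; _∷_; allFin; concatMap; map; tabulate)
open import Data.List.Membership.Propositional using (_∈_)
open import Data.List.Membership.Propositional.Properties using (∈-allFin; ∈-concatMap⁺; ∈-++⁺ʳ)
open import Data.List.Properties using (map-tabulate)
open import Data.List.Relation.Unary.All as All using (All; []; _∷_; universal)
open import Data.List.Relation.Unary.All.Properties using (concat⁺; map⁺)
open import Data.List.Relation.Unary.Any as Any using (here; there)
open import Data.List.Relation.Unary.First using (FirstView; _++_∷_; first)
open import Data.List.Relation.Unary.First.Properties using (toView)
open import Data.Nat using (zero; suc; _+_; _*_; _∸_; _⊓_; _%_; ∣_-_∣; _<_; _<?_; _≤?_; NonZero; z≤n; s≤s; ⌊_/2⌋; ⌈_/2⌉)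
open import Data.Nat.DivMod using (m%n<n; m%n%n≡m%n; [m+n]%n≡m%n; %-distribˡ-+; m<n⇒m%n≡m; m≤n⇒[n∸m]%m≡n%m)
open import Data.Nat.ListAction using (sum)
open import Data.Nat.Properties
open import Data.Nat.Tactic.RingSolver using (solve-∀)
open import Algebra.Properties.CommutativeSemigroup +-commutativeSemigroup using () renaming (interchange to +-interchange; xy∙z≈xz∙y to xy+z≡xz+y; xy∙z≈x∙zy to xy+z≡x+zy; xy∙z≈zy∙x to xy+z≡zy+x)
open import Data.Product using (_,_; proj₂; uncurry)
open import Data.Sum using (_⊎_; inj₁; inj₂; [_,_])
open import Data.Vec using ([]; _∷_; lookup; _[_]≔_)
open import Data.Vec.Properties using (lookup∘update; lookup∘update′)
open import Function using (_∘_; id)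
open import Relation.Binary.PropositionalEquality using (refl; sym; trans; cong; cong₂; subst; subst₂; _≢_; module ≡-Reasoning)
open import Relation.Nullary using (¬_; does; yes; no; contradiction)
open import Relation.Nullary.Decidable using (⌊_⌋; dec-true; dec-false)

-- Finite sums

∑ : ℕ → (ℕ → ℕ) → ℕ
∑ zero    f = 0
∑ (suc n) f = f 0 + ∑ n (f ∘ suc)

infix 6.5 ∑
syntax ∑ n (λ i → e) = ∑[ i < n ] e

∑-cong : ∀ n {f g : ℕ → ℕ} → (∀ i → i < n → f i ≡ g i) → ∑ n f ≡ ∑ n g
∑-cong zero    f≗g = refl
∑-cong (suc n) f≗g = cong₂ _+_ (f≗g 0 (s≤s z≤n)) (∑-cong n λ i i<n → f≗g (suc i) (s≤s i<n))

∑-mono-≤ : ∀ n {f g : ℕ → ℕ} → (∀ i → i < n → f i ≤ g i) → ∑ n f ≤ ∑ n g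
∑-mono-≤ zero    f≤g = z≤n
∑-mono-≤ (suc n) f≤g = +-mono-≤ (f≤g 0 (s≤s z≤n)) (∑-mono-≤ n λ i i<n → f≤g (suc i) (s≤s i<n))

∑-const : ∀ n c → ∑[ _ < n ] c ≡ n * c
∑-const zero    c = refl
∑-const (suc n) c = cong (c +_) (∑-const n c)

∑-split : ∀ a b f → ∑ (a + b) f ≡ ∑ a f + ∑[ i < b ] f (a + i)
∑-split zero    b f = refl
∑-split (suc a) b f = trans (cong (f 0 +_) (∑-split a b (f ∘ suc))) (sym (+-assoc (f 0) _ _))

∑-snoc : ∀ n f → ∑ (suc n) f ≡ ∑ n f + f n
∑-snoc zero    f = +-comm (f 0) 0
∑-snoc (suc n) f = trans (cong (f 0 +_) (∑-snoc n (f ∘ suc))) (sym (+-assoc (f 0) _ _))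

∑-shift : ∀ n f → ∑[ i < n ] f (suc i) + f 0 ≡ ∑ n f + f n
∑-shift n f = trans (+-comm _ (f 0)) (∑-snoc n f)

∑-distrib-+ : ∀ n f g → ∑[ i < n ] (f i + g i) ≡ ∑ n f + ∑ n g
∑-distrib-+ zero    f g = refl
∑-distrib-+ (suc n) f g =
  trans (cong (f 0 + g 0 +_) (∑-distrib-+ n (f ∘ suc) (g ∘ suc))) (+-interchange (f 0) (g 0) _ _)

*-distribˡ-∑ : ∀ n c f → c * ∑ n f ≡ ∑[ i < n ] (c * f i)
*-distribˡ-∑ zero    c f = *-zeroʳ c
*-distribˡ-∑ (suc n) c f = trans (*-distribˡ-+ c (f 0) _) (cong (c * f 0 +_) (*-distribˡ-∑ n c (f ∘ suc)))

*-distribʳ-∑ : ∀ n c f → ∑ n f * c ≡ ∑[ i < n ] (f i * c)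
*-distribʳ-∑ n c f = trans (*-comm (∑ n f) c) (trans (*-distribˡ-∑ n c f) (∑-cong n λ i _ → *-comm c (f i)))

∑-comm : ∀ n m (f : ℕ → ℕ → ℕ) → ∑[ i < n ] ∑[ j < m ] f i j ≡ ∑[ j < m ] ∑[ i < n ] f i j
∑-comm zero    m f = sym (trans (∑-const m 0) (*-zeroʳ m))
∑-comm (suc n) m f = trans (cong (∑ m (f 0) +_) (∑-comm n m (f ∘ suc))) (sym (∑-distrib-+ m (f 0) _))

∑-reverse : ∀ n f → ∑[ i < n ] f (n ∸ suc i) ≡ ∑ n f
∑-reverse zero    f = refl
∑-reverse (suc n) f = trans (cong (f n +_) (∑-reverse n f)) (trans (+-comm (f n) _) (sym (∑-snoc n f)))

∑-rotate : ∀ n f → (∀ i → f (i + n) ≡ f i) → ∀ c → ∑[ i < n ] f (c + i) ≡ ∑ n f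
∑-rotate n f f-periodic zero    = refl
∑-rotate n f f-periodic (suc c) = trans (+-cancelʳ-≡ (f c) _ _ shifted) (∑-rotate n f f-periodic c)
  where
  open ≡-Reasoning
  shifted : ∑[ i < n ] f (suc c + i) + f c ≡ ∑[ i < n ] f (c + i) + f c
  shifted = begin
    ∑[ i < n ] f (suc c + i) + f c       ≡⟨ cong₂ _+_ (∑-cong n λ i _ → cong f (sym (+-suc c i))) (cong f (sym (+-identityʳ c))) ⟩
    ∑[ i < n ] f (c + suc i) + f (c + 0) ≡⟨ ∑-shift n (λ i → f (c + i)) ⟩
    ∑[ i < n ] f (c + i) + f (c + n)     ≡⟨ cong (∑[ i < n ] f (c + i) +_) (f-periodic c) ⟩
    ∑[ i < n ] f (c + i) + f c           ∎

∑-telescope : ∀ n {f g e : ℕ → ℕ} → (∀ i → f i + e i ≡ g i + e (suc i)) → ∑ n f + e 0 ≡ ∑ n g + e n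
∑-telescope zero    balance = refl
∑-telescope (suc n) {f} {g} {e} balance = begin
  f 0 + ∑ n (f ∘ suc) + e 0         ≡⟨ xy+z≡xz+y (f 0) _ (e 0) ⟩
  f 0 + e 0 + ∑ n (f ∘ suc)         ≡⟨ cong (_+ ∑ n (f ∘ suc)) (balance 0) ⟩
  g 0 + e 1 + ∑ n (f ∘ suc)         ≡⟨ xy+z≡x+zy (g 0) (e 1) _ ⟩
  g 0 + (∑ n (f ∘ suc) + e 1)       ≡⟨ cong (g 0 +_) (∑-telescope n (balance ∘ suc)) ⟩
  g 0 + (∑ n (g ∘ suc) + e (suc n)) ≡⟨ sym (+-assoc (g 0) _ _) ⟩
  g 0 + ∑ n (g ∘ suc) + e (suc n)   ∎
  where open ≡-Reasoning

∑-agree-except : ∀ N {f g : ℕ → ℕ} p → p < N → (∀ i → i < N → i ≢ p → f i ≡ g i) →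
                 ∑ N f + g p ≡ ∑ N g + f p
∑-agree-except (suc N) {f} {g} zero    _ agree = begin
  f 0 + ∑ N (f ∘ suc) + g 0 ≡⟨ cong (λ t → f 0 + t + g 0) (∑-cong N λ i i<N → agree (suc i) (s≤s i<N) λ ()) ⟩
  f 0 + ∑ N (g ∘ suc) + g 0 ≡⟨ xy+z≡zy+x (f 0) _ (g 0) ⟩
  g 0 + ∑ N (g ∘ suc) + f 0 ∎
  where open ≡-Reasoning
∑-agree-except (suc N) {f} {g} (suc p) (s≤s p<N) agree = begin
  f 0 + ∑ N (f ∘ suc) + g (suc p)   ≡⟨ +-assoc (f 0) _ _ ⟩
  f 0 + (∑ N (f ∘ suc) + g (suc p)) ≡⟨ cong₂ _+_ (agree 0 (s≤s z≤n) λ ()) tails ⟩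
  g 0 + (∑ N (g ∘ suc) + f (suc p)) ≡⟨ sym (+-assoc (g 0) _ _) ⟩
  g 0 + ∑ N (g ∘ suc) + f (suc p)   ∎
  where
  open ≡-Reasoning
  tails : ∑ N (f ∘ suc) + g (suc p) ≡ ∑ N (g ∘ suc) + f (suc p)
  tails = ∑-agree-except N p p<N λ i i<N i≢p → agree (suc i) (s≤s i<N) (i≢p ∘ suc-injective)

private
  ∑-agree-except-0-and : ∀ N {f g : ℕ → ℕ} q → q < N → (∀ i → i < suc N → i ≢ 0 → i ≢ suc q → f i ≡ g i) →
                         ∑ (suc N) f + (g 0 + g (suc q)) ≡ ∑ (suc N) g + (f 0 + f (suc q))
  ∑-agree-except-0-and N {f} {g} q q<N agree = begin
    f 0 + ∑ N (f ∘ suc) + (g 0 + g (suc q)) ≡⟨ regroup (f 0) _ (g 0) _ ⟩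
    ∑ N (f ∘ suc) + g (suc q) + (f 0 + g 0) ≡⟨ cong (_+ (f 0 + g 0)) tails ⟩
    ∑ N (g ∘ suc) + f (suc q) + (f 0 + g 0) ≡⟨ regroup′ (g 0) _ (f 0) _ ⟩
    g 0 + ∑ N (g ∘ suc) + (f 0 + f (suc q)) ∎
    where
    open ≡-Reasoning
    regroup : ∀ a b c d → a + b + (c + d) ≡ b + d + (a + c)
    regroup = solve-∀
    regroup′ : ∀ a b c d → b + d + (c + a) ≡ a + b + (c + d)
    regroup′ = solve-∀
    tails : ∑ N (f ∘ suc) + g (suc q) ≡ ∑ N (g ∘ suc) + f (suc q)
    tails = ∑-agree-except N q q<N λ i i<N i≢q → agree (suc i) (s≤s i<N) (λ ()) (i≢q ∘ suc-injective)

∑-agree-except₂ : ∀ N {f g : ℕ → ℕ} p q → p < N → q < N → p ≢ q →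
                  (∀ i → i < N → i ≢ p → i ≢ q → f i ≡ g i) →
                  ∑ N f + (g p + g q) ≡ ∑ N g + (f p + f q)
∑-agree-except₂ (suc N) zero    zero    _ _ 0≢0 _ = contradiction refl 0≢0
∑-agree-except₂ (suc N) zero    (suc q) _ (s≤s q<N) _ agree = ∑-agree-except-0-and N q q<N agree
∑-agree-except₂ (suc N) {f} {g} (suc p) zero (s≤s p<N) _ _ agree =
  trans (cong (∑ (suc N) f +_) (+-comm (g (suc p)) (g 0)))
    (trans (∑-agree-except-0-and N p p<N λ i i<N i≢0 i≢p → agree i i<N i≢p i≢0)
      (cong (∑ (suc N) g +_) (+-comm (f 0) (f (suc p)))))
∑-agree-except₂ (suc N) {f} {g} (suc p) (suc q) (s≤s p<N) (s≤s q<N) p≢q agree = begin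
  f 0 + ∑ N (f ∘ suc) + (g (suc p) + g (suc q))   ≡⟨ +-assoc (f 0) _ _ ⟩
  f 0 + (∑ N (f ∘ suc) + (g (suc p) + g (suc q))) ≡⟨ cong₂ _+_ (agree 0 (s≤s z≤n) (λ ()) (λ ())) tails ⟩
  g 0 + (∑ N (g ∘ suc) + (f (suc p) + f (suc q))) ≡⟨ sym (+-assoc (g 0) _ _) ⟩
  g 0 + ∑ N (g ∘ suc) + (f (suc p) + f (suc q))   ∎
  where
  open ≡-Reasoning
  tails : ∑ N (f ∘ suc) + (g (suc p) + g (suc q)) ≡ ∑ N (g ∘ suc) + (f (suc p) + f (suc q))
  tails = ∑-agree-except₂ N p q p<N q<N (p≢q ∘ cong suc)
    λ i i<N i≢p i≢q → agree (suc i) (s≤s i<N) (i≢p ∘ suc-injective) (i≢q ∘ suc-injective)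

∑-<-two-points : ∀ N {f g : ℕ → ℕ} p q → p < N → q < N → p ≢ q →
                 (∀ i → i < N → i ≢ p → i ≢ q → f i ≡ g i) →
                 f p + f q < g p + g q → ∑ N f < ∑ N g
∑-<-two-points N {f} {g} p q p<N q<N p≢q agree gain = +-cancelʳ-< (g p + g q) (∑ N f) (∑ N g) (begin-strict
  ∑ N f + (g p + g q) ≡⟨ ∑-agree-except₂ N p q p<N q<N p≢q agree ⟩
  ∑ N g + (f p + f q) <⟨ +-monoʳ-< (∑ N g) gain ⟩
  ∑ N g + (g p + g q) ∎)
  where open ≤-Reasoning

sum-map-allFin : ∀ {N} (f : Fin N → ℕ) (g : ℕ → ℕ) → (∀ u → f u ≡ g (toℕ u)) → sum (map f (allFin N)) ≡ ∑ N g
sum-map-allFin {N} f g f≗g = trans (cong sum (map-tabulate id f)) (sum-tabulate f g f≗g)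
  where
  sum-tabulate : ∀ {M} (f : Fin M → ℕ) g → (∀ u → f u ≡ g (toℕ u)) → sum (tabulate f) ≡ ∑ M g
  sum-tabulate {zero}  f g f≗g = refl
  sum-tabulate {suc M} f g f≗g = cong₂ _+_ (f≗g zero) (sum-tabulate (f ∘ suc) (g ∘ suc) (f≗g ∘ suc))

sum-map-allFin-≤ : ∀ {N} (f : Fin N → ℕ) {c} → (∀ u → f u ≤ c) → sum (map f (allFin N)) ≤ N * c
sum-map-allFin-≤ {N} f {c} f≤c = subst (_≤ N * c) (sym (cong sum (map-tabulate id f))) (sum-tabulate-≤ f f≤c)
  where
  sum-tabulate-≤ : ∀ {M} (g : Fin M → ℕ) → (∀ u → g u ≤ c) → sum (tabulate g) ≤ M * c
  sum-tabulate-≤ {zero}  g g≤c = z≤n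
  sum-tabulate-≤ {suc M} g g≤c = +-mono-≤ (g≤c zero) (sum-tabulate-≤ (g ∘ suc) (g≤c ∘ suc))

-- Half-cycle arcs and cyclic lengths

⌈n/2⌉≤1+⌊n/2⌋ : ∀ n → ⌈ n /2⌉ ≤ suc ⌊ n /2⌋
⌈n/2⌉≤1+⌊n/2⌋ zero          = z≤n
⌈n/2⌉≤1+⌊n/2⌋ (suc zero)    = s≤s z≤n
⌈n/2⌉≤1+⌊n/2⌋ (suc (suc n)) = s≤s (⌈n/2⌉≤1+⌊n/2⌋ n)

⌊n/2⌋+⌊n/2⌋≤n : ∀ n → ⌊ n /2⌋ + ⌊ n /2⌋ ≤ n
⌊n/2⌋+⌊n/2⌋≤n n = begin
  ⌊ n /2⌋ + ⌊ n /2⌋ ≤⟨ +-monoʳ-≤ ⌊ n /2⌋ (⌊n/2⌋≤⌈n/2⌉ n) ⟩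
  ⌊ n /2⌋ + ⌈ n /2⌉ ≡⟨ ⌊n/2⌋+⌈n/2⌉≡n n ⟩
  n                 ∎
  where open ≤-Reasoning

n≤1+⌊n/2⌋+⌊n/2⌋ : ∀ n → n ≤ suc (⌊ n /2⌋ + ⌊ n /2⌋)
n≤1+⌊n/2⌋+⌊n/2⌋ n = begin
  n                       ≡⟨ sym (⌊n/2⌋+⌈n/2⌉≡n n) ⟩
  ⌊ n /2⌋ + ⌈ n /2⌉       ≤⟨ +-monoʳ-≤ ⌊ n /2⌋ (⌈n/2⌉≤1+⌊n/2⌋ n) ⟩
  ⌊ n /2⌋ + suc ⌊ n /2⌋   ≡⟨ +-suc ⌊ n /2⌋ ⌊ n /2⌋ ⟩
  suc (⌊ n /2⌋ + ⌊ n /2⌋) ∎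
  where open ≤-Reasoning

cycLen : ℕ → ℕ → ℕ
cycLen n δ = δ ⊓ (n ∸ δ)

cycLen-reflect : ∀ {n δ} → δ ≤ n → cycLen n (n ∸ δ) ≡ cycLen n δ
cycLen-reflect {n} {δ} δ≤n = trans (cong ((n ∸ δ) ⊓_) (m∸[m∸n]≡n δ≤n)) (⊓-comm (n ∸ δ) δ)

𝟙[_<_] : ℕ → ℕ → ℕ
𝟙[ a < b ] = if does (a <? b) then 1 else 0

𝟙[<]≡1 : ∀ {a b} → a < b → 𝟙[ a < b ] ≡ 1
𝟙[<]≡1 {a} {b} a<b rewrite dec-true (a <? b) a<b = refl

𝟙[<]≡0 : ∀ {a b} → b ≤ a → 𝟙[ a < b ] ≡ 0
𝟙[<]≡0 {a} {b} b≤a rewrite dec-false (a <? b) (≤⇒≯ b≤a) = refl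

cycLen-suc : ∀ {n δ} → δ ≤ n → cycLen (suc n) δ ≡ cycLen n δ + 𝟙[ ⌊ n /2⌋ < δ ]
cycLen-suc {n} {δ} δ≤n with ⌊ n /2⌋ <? δ
... | no  δ≯⌊n/2⌋ = begin
  δ ⊓ (suc n ∸ δ)                ≡⟨ m≤n⇒m⊓n≡m (≤-trans δ≤n∸δ (∸-monoˡ-≤ δ (n≤1+n n))) ⟩
  δ                              ≡⟨ sym (m≤n⇒m⊓n≡m δ≤n∸δ) ⟩
  δ ⊓ (n ∸ δ)                    ≡⟨ sym (+-identityʳ _) ⟩
  δ ⊓ (n ∸ δ) + 0                ≡⟨ cong (δ ⊓ (n ∸ δ) +_) (sym (𝟙[<]≡0 (≮⇒≥ δ≯⌊n/2⌋))) ⟩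
  δ ⊓ (n ∸ δ) + 𝟙[ ⌊ n /2⌋ < δ ] ∎
  where
  open ≡-Reasoning
  δ≤n∸δ : δ ≤ n ∸ δ
  δ≤n∸δ = m+n≤o⇒m≤o∸n δ (≤-trans (+-mono-≤ (≮⇒≥ δ≯⌊n/2⌋) (≮⇒≥ δ≯⌊n/2⌋)) (⌊n/2⌋+⌊n/2⌋≤n n))
... | yes ⌊n/2⌋<δ = begin
  δ ⊓ (suc n ∸ δ)                ≡⟨ m≥n⇒m⊓n≡n 1+n∸δ≤δ ⟩
  suc n ∸ δ                      ≡⟨ +-∸-assoc 1 δ≤n ⟩
  suc (n ∸ δ)                    ≡⟨ +-comm 1 (n ∸ δ) ⟩
  n ∸ δ + 1                      ≡⟨ cong (_+ 1) (sym (m≥n⇒m⊓n≡n (≤-trans (∸-monoˡ-≤ δ (n≤1+n n)) 1+n∸δ≤δ))) ⟩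
  δ ⊓ (n ∸ δ) + 1                ≡⟨ cong (δ ⊓ (n ∸ δ) +_) (sym (𝟙[<]≡1 ⌊n/2⌋<δ)) ⟩
  δ ⊓ (n ∸ δ) + 𝟙[ ⌊ n /2⌋ < δ ] ∎
  where
  open ≡-Reasoning
  1+n∸δ≤δ : suc n ∸ δ ≤ δ
  1+n∸δ≤δ = m≤n+o⇒m∸n≤o (suc n) δ (≤-trans (s≤s (n≤1+⌊n/2⌋+⌊n/2⌋ n))
              (≤-trans (≤-reflexive (cong suc (sym (+-suc _ _)))) (+-mono-≤ ⌊n/2⌋<δ ⌊n/2⌋<δ)))

∑-above : ∀ r s (P : ℕ → ℕ) → ∑[ δ < suc r + s ] 𝟙[ r < δ ] * P δ ≡ ∑[ j < s ] P (suc r + j)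
∑-above r s P = begin
  ∑[ δ < suc r + s ] 𝟙[ r < δ ] * P δ
    ≡⟨ ∑-split (suc r) s (λ δ → 𝟙[ r < δ ] * P δ) ⟩
  ∑[ δ < suc r ] 𝟙[ r < δ ] * P δ + ∑[ j < s ] 𝟙[ r < suc r + j ] * P (suc r + j)
    ≡⟨ cong₂ _+_ (trans (∑-cong (suc r) below) (trans (∑-const (suc r) 0) (*-zeroʳ (suc r)))) (∑-cong s above) ⟩
  0 + ∑[ j < s ] P (suc r + j)
    ∎
  where
  open ≡-Reasoning
  below : ∀ δ → δ < suc r → 𝟙[ r < δ ] * P δ ≡ 0
  below δ δ<1+r = cong (_* P δ) (𝟙[<]≡0 (≤-pred δ<1+r))
  above : ∀ j → j < s → 𝟙[ r < suc r + j ] * P (suc r + j) ≡ P (suc r + j)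
  above j _ = trans (cong (_* P (suc r + j)) (𝟙[<]≡1 (s≤s (m≤m+n r j)))) (+-identityʳ _)

-- There are exactly cycLen n δ pairs (a , j) with a < ⌈n/2⌉, j < ⌊n/2⌋ and 1 + a + j = δ.
∑-window-offsets : ∀ n (P : ℕ → ℕ) →
  ∑[ a < ⌈ n /2⌉ ] ∑[ j < ⌊ n /2⌋ ] P (suc (a + j)) ≡ ∑[ δ < n ] cycLen n δ * P δ
∑-window-offsets zero    P = refl
∑-window-offsets (suc n) P = begin
  ∑[ a < suc r ] ∑[ j < s ] P (suc (a + j))
    ≡⟨ ∑-snoc r _ ⟩
  ∑[ a < r ] ∑[ j < s ] P (suc (a + j)) + ∑[ j < s ] P (suc r + j)
    ≡⟨ cong₂ _+_ previous (sym (∑-above r s P)) ⟩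
  ∑[ δ < n ] cycLen n δ * P δ + ∑[ δ < suc r + s ] 𝟙[ r < δ ] * P δ
    ≡⟨ cong₂ _+_ (sym extend) (cong (λ m → ∑[ δ < m ] 𝟙[ r < δ ] * P δ) 1+r+s≡1+n) ⟩
  ∑[ δ < suc n ] cycLen n δ * P δ + ∑[ δ < suc n ] 𝟙[ r < δ ] * P δ
    ≡⟨ sym (∑-distrib-+ (suc n) (λ δ → cycLen n δ * P δ) (λ δ → 𝟙[ r < δ ] * P δ)) ⟩
  ∑[ δ < suc n ] (cycLen n δ * P δ + 𝟙[ r < δ ] * P δ)
    ≡⟨ ∑-cong (suc n) merge ⟩
  ∑[ δ < suc n ] cycLen (suc n) δ * P δ
    ∎
  where
  open ≡-Reasoning
  r = ⌊ n /2⌋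
  s = ⌈ n /2⌉
  1+r+s≡1+n : suc r + s ≡ suc n
  1+r+s≡1+n = cong suc (⌊n/2⌋+⌈n/2⌉≡n n)
  merge : ∀ δ → δ < suc n → cycLen n δ * P δ + 𝟙[ r < δ ] * P δ ≡ cycLen (suc n) δ * P δ
  merge δ δ<1+n = trans (sym (*-distribʳ-+ (P δ) (cycLen n δ) 𝟙[ r < δ ])) (cong (_* P δ) (sym (cycLen-suc (≤-pred δ<1+n))))
  previous : ∑[ a < r ] ∑[ j < s ] P (suc (a + j)) ≡ ∑[ δ < n ] cycLen n δ * P δ
  previous = trans (∑-comm r s _) (trans (∑-cong s λ j _ → ∑-cong r λ a _ → cong (P ∘ suc) (+-comm a j)) (∑-window-offsets n P))
  extend : ∑[ δ < suc n ] cycLen n δ * P δ ≡ ∑[ δ < n ] cycLen n δ * P δ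
  extend = begin
    ∑[ δ < suc n ] cycLen n δ * P δ                  ≡⟨ ∑-snoc n (λ δ → cycLen n δ * P δ) ⟩
    ∑[ δ < n ] cycLen n δ * P δ + n ⊓ (n ∸ n) * P n ≡⟨ cong (λ z → ∑[ δ < n ] cycLen n δ * P δ + n ⊓ z * P n) (n∸n≡0 n) ⟩
    ∑[ δ < n ] cycLen n δ * P δ + n ⊓ 0 * P n       ≡⟨ cong (λ z → ∑[ δ < n ] cycLen n δ * P δ + z * P n) (⊓-zeroʳ n) ⟩
    ∑[ δ < n ] cycLen n δ * P δ + 0                 ≡⟨ +-identityʳ _ ⟩
    ∑[ δ < n ] cycLen n δ * P δ                     ∎

m+n≡o⇒o∸m≡n : ∀ {m n o} → m + n ≡ o → o ∸ m ≡ n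
m+n≡o⇒o∸m≡n {m} {n} refl = m+n∸m≡n m n

m+o≡n+p∧p≤o⇒m≤n : ∀ {m n o p} → m + o ≡ n + p → p ≤ o → m ≤ n
m+o≡n+p∧p≤o⇒m≤n {m} {n} {o} eq p≤o = +-cancelʳ-≤ o m n (≤-trans (≤-reflexive eq) (+-monoʳ-≤ n p≤o))

m+m<n+n⇒m<n : ∀ {m n} → m + m < n + n → m < n
m+m<n+n⇒m<n {m} {n} m+m<n+n with m <? n
... | yes m<n = m<n
... | no  m≮n = contradiction m+m<n+n (≤⇒≯ (+-mono-≤ (≮⇒≥ m≮n) (≮⇒≥ m≮n)))

m+m≤1+n+n⇒m≤n : ∀ {m n} → m + m ≤ suc (n + n) → m ≤ n
m+m≤1+n+n⇒m≤n {m} {n} m+m≤1+n+n with m ≤? n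
... | yes m≤n = m≤n
... | no  m≰n = contradiction
  (≤-trans (≤-reflexive (cong suc (sym (+-suc n n)))) (≤-trans (+-mono-≤ (≰⇒> m≰n) (≰⇒> m≰n)) m+m≤1+n+n)) 1+n≰n

complement-flip : ∀ {a b a′ b′ c} → a′ + a ≡ c → b′ + b ≡ c → a + 2 ≤ b → b′ + 2 ≤ a′
complement-flip {a} {b} {a′} {b′} a′+a≡c b′+b≡c a+2≤b = +-cancelʳ-≤ a (b′ + 2) a′ (begin
  b′ + 2 + a   ≡⟨ xy+z≡x+zy b′ 2 a ⟩
  b′ + (a + 2) ≤⟨ +-monoʳ-≤ b′ a+2≤b ⟩
  b′ + b       ≡⟨ trans b′+b≡c (sym a′+a≡c) ⟩
  a′ + a       ∎)
  where open ≤-Reasoning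

upward-closed : ∀ (P : ℕ → Set) → (∀ t → P t → P (suc t)) → ∀ {a b} → a ≤ b → P a → P b
upward-closed P up {b = zero}  z≤n   pa = pa
upward-closed P up {b = suc b} a≤1+b pa with m≤n⇒m<n∨m≡n a≤1+b
... | inj₁ a<1+b = up b (upward-closed P up (≤-pred a<1+b) pa)
... | inj₂ refl  = pa

downward-closed : ∀ (P : ℕ → Set) → (∀ t → P (suc t) → P t) → ∀ {a b} → a ≤ b → P b → P a
downward-closed P down {b = zero}  z≤n   pb = pb
downward-closed P down {b = suc b} a≤1+b pb with m≤n⇒m<n∨m≡n a≤1+b
... | inj₁ a<1+b = downward-closed P down (≤-pred a<1+b) (down b pb)
... | inj₂ refl  = pb

-- The number of pairs of an m-set separated by a part of size a

cut : ℕ → ℕ → ℕ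
cut m a = a * (m ∸ a)

cut-transfer : ∀ {m a a′ b b′} → a′ + 1 ≡ a → b′ ≡ b + 1 → b + 2 ≤ a → a ≤ m →
               cut m a + cut m b < cut m a′ + cut m b′
cut-transfer {m} {a′ = a′} {b} refl refl b+2≤a a≤m
  with m≤n⇒∃[o]m+o≡n (+-cancelʳ-≤ 1 (b + 1) a′ (subst (_≤ a′ + 1) (sym (+-assoc b 1 1)) b+2≤a)) | m≤n⇒∃[o]m+o≡n a≤m
... | e , refl | g , refl = begin-strict
  cut m (a′ + 1) + cut m b                     ≡⟨ cong₂ (λ y z → (a′ + 1) * y + b * z) m∸[a′+1]≡g m∸b≡2+e+g ⟩
  (a′ + 1) * g + b * (2 + e + g)               <⟨ m<m+n _ (s≤s z≤n) ⟩
  (a′ + 1) * g + b * (2 + e + g) + (2 + e + e) ≡⟨ gain b e g ⟩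
  a′ * (1 + g) + (b + 1) * (1 + e + g)         ≡⟨ sym (cong₂ (λ y z → a′ * y + (b + 1) * z) m∸a′≡1+g m∸[b+1]≡1+e+g) ⟩
  cut m a′ + cut m (b + 1)                     ∎
  where
  open ≤-Reasoning
  b+[2+e+g]≡m : ∀ b e g → b + (2 + e + g) ≡ b + 1 + e + 1 + g
  b+[2+e+g]≡m = solve-∀
  a′+[1+g]≡m : ∀ b e g → b + 1 + e + (1 + g) ≡ b + 1 + e + 1 + g
  a′+[1+g]≡m = solve-∀
  b+1+[1+e+g]≡m : ∀ b e g → b + 1 + (1 + e + g) ≡ b + 1 + e + 1 + g
  b+1+[1+e+g]≡m = solve-∀
  gain : ∀ b e g → (b + 1 + e + 1) * g + b * (2 + e + g) + (2 + e + e) ≡ (b + 1 + e) * (1 + g) + (b + 1) * (1 + e + g)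
  gain = solve-∀
  m∸[a′+1]≡g : m ∸ (a′ + 1) ≡ g
  m∸[a′+1]≡g = m+n≡o⇒o∸m≡n {a′ + 1} refl
  m∸b≡2+e+g : m ∸ b ≡ 2 + e + g
  m∸b≡2+e+g = m+n≡o⇒o∸m≡n (b+[2+e+g]≡m b e g)
  m∸a′≡1+g : m ∸ a′ ≡ 1 + g
  m∸a′≡1+g = m+n≡o⇒o∸m≡n {a′} (a′+[1+g]≡m b e g)
  m∸[b+1]≡1+e+g : m ∸ (b + 1) ≡ 1 + e + g
  m∸[b+1]≡1+e+g = m+n≡o⇒o∸m≡n {b + 1} (b+1+[1+e+g]≡m b e g)

cut-≤-half : ∀ h {a} → a ≤ suc (h + h) → cut (suc (h + h)) a ≤ h * suc h
cut-≤-half h {a} a≤c with ≤-<-connex a h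
... | inj₁ a≤h with m≤n⇒∃[o]m+o≡n a≤h
...   | e , refl = begin
  cut (suc (h + h)) a                ≡⟨ cong (a *_) (m+n≡o⇒o∸m≡n (a+[c∸a]≡c a e)) ⟩
  a * suc (a + e + e)                ≤⟨ m≤m+n _ (e * e + e) ⟩
  a * suc (a + e + e) + (e * e + e)  ≡⟨ deficit a e ⟩
  (a + e) * suc (a + e)              ∎
  where
  open ≤-Reasoning
  a+[c∸a]≡c : ∀ a e → a + suc (a + e + e) ≡ suc (a + e + (a + e))
  a+[c∸a]≡c = solve-∀
  deficit : ∀ a e → a * suc (a + e + e) + (e * e + e) ≡ (a + e) * suc (a + e)
  deficit = solve-∀
cut-≤-half h {a} a≤c | inj₂ h<a with m≤n⇒∃[o]m+o≡n h<a
...   | e , refl with m≤n⇒∃[o]m+o≡n (+-cancelˡ-≤ (suc h) e h a≤c)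
...     | g , refl = begin
  cut (suc (e + g + (e + g))) a      ≡⟨ cong (a *_) (m+n≡o⇒o∸m≡n (a+[c∸a]≡c e g)) ⟩
  a * g                              ≤⟨ m≤m+n _ (e * e + e) ⟩
  a * g + (e * e + e)                ≡⟨ deficit e g ⟩
  (e + g) * suc (e + g)              ∎
  where
  open ≤-Reasoning
  a+[c∸a]≡c : ∀ e g → suc (e + g) + e + g ≡ suc (e + g + (e + g))
  a+[c∸a]≡c = solve-∀
  deficit : ∀ e g → (suc (e + g) + e) * g + (e * e + e) ≡ (e + g) * suc (e + g)
  deficit = solve-∀

cut-near-half : ∀ h {a} → h ≤ a → a ≤ suc h → cut (suc (h + h)) a ≡ h * suc h
cut-near-half h {a} h≤a a≤1+h with m≤n⇒m<n∨m≡n a≤1+h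
... | inj₁ a<1+h rewrite ≤-antisym (≤-pred a<1+h) h≤a = cong (h *_) (m+n≡o⇒o∸m≡n (+-suc h h))
... | inj₂ refl = trans (cong (suc h *_) (m+n≡o⇒o∸m≡n {suc h} refl)) (*-comm (suc h) h)

cut-extend : ∀ {m a} d → a ≤ m → cut (m + d) a ≡ cut m a + d * a
cut-extend {m} {a} d a≤m = begin
  a * (m + d ∸ a)     ≡⟨ cong (a *_) (+-∸-comm d a≤m) ⟩
  a * (m ∸ a + d)     ≡⟨ *-distribˡ-+ a (m ∸ a) d ⟩
  a * (m ∸ a) + a * d ≡⟨ cong (a * (m ∸ a) +_) (*-comm a d) ⟩
  a * (m ∸ a) + d * a ∎
  where open ≡-Reasoning

-- Subsets, perturbations and ascending local search

bit : Bool → ℕ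
bit true  = 1
bit false = 0

bit≤1 : ∀ b → bit b ≤ 1
bit≤1 true  = ≤-refl
bit≤1 false = z≤n

bit≡1⇒true : ∀ {b} → bit b ≡ 1 → b ≡ true
bit≡1⇒true {true} _ = refl

bit≡0⇒false : ∀ {b} → bit b ≡ 0 → b ≡ false
bit≡0⇒false {false} _ = refl

∣p∣≡∑ : ∀ {N} (p : Subset N) (g : ℕ → ℕ) → (∀ u → g (toℕ u) ≡ bit (lookup p u)) → ∣ p ∣ ≡ ∑ N g
∣p∣≡∑ []          g g≗p = refl
∣p∣≡∑ (true  ∷ p) g g≗p = cong₂ _+_ (sym (g≗p zero)) (∣p∣≡∑ p (g ∘ suc) (g≗p ∘ suc))
∣p∣≡∑ (false ∷ p) g g≗p = cong₂ _+_ (sym (g≗p zero)) (∣p∣≡∑ p (g ∘ suc) (g≗p ∘ suc))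

∣p[i]≔b∣ : ∀ {N} (p : Subset N) i b → ∣ p [ i ]≔ b ∣ + bit (lookup p i) ≡ ∣ p ∣ + bit b
∣p[i]≔b∣ (true  ∷ p) zero    true  = refl
∣p[i]≔b∣ (true  ∷ p) zero    false = trans (+-comm ∣ p ∣ 1) (sym (+-identityʳ (suc ∣ p ∣)))
∣p[i]≔b∣ (false ∷ p) zero    true  = trans (+-identityʳ (suc ∣ p ∣)) (+-comm 1 ∣ p ∣)
∣p[i]≔b∣ (false ∷ p) zero    false = refl
∣p[i]≔b∣ (true  ∷ p) (suc i) b     = cong suc (∣p[i]≔b∣ p i b)
∣p[i]≔b∣ (false ∷ p) (suc i) b     = ∣p[i]≔b∣ p i b

in≢out : ∀ {N} {X : Subset N} {u v} → lookup X u ≡ true → lookup X v ≡ false → u ≢ v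
in≢out u∈X v∉X refl with trans (sym u∈X) v∉X
... | ()

module _ {N} {X : Subset N} {u v : Fin N} where

  lookup-perturb-source : u ≢ v → lookup (perturb X u v) u ≡ false
  lookup-perturb-source u≢v = trans (lookup∘update′ u≢v (X [ u ]≔ false) true) (lookup∘update u X false)

  lookup-perturb-target : lookup (perturb X u v) v ≡ true
  lookup-perturb-target = lookup∘update v (X [ u ]≔ false) true

  lookup-perturb-other : ∀ {w} → w ≢ u → w ≢ v → lookup (perturb X u v) w ≡ lookup X w
  lookup-perturb-other w≢u w≢v = trans (lookup∘update′ w≢v (X [ u ]≔ false) true) (lookup∘update′ w≢u X false)

  ∣perturb∣ : lookup X u ≡ true → lookup X v ≡ false → ∣ perturb X u v ∣ ≡ ∣ X ∣
  ∣perturb∣ u∈X v∉X = +-cancelʳ-≡ 0 _ _ (begin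
    ∣ Y ∣ + 0                ≡⟨ cong (λ b → ∣ Y ∣ + bit b) (sym Zv≡false) ⟩
    ∣ Y ∣ + bit (lookup Z v) ≡⟨ ∣p[i]≔b∣ Z v true ⟩
    ∣ Z ∣ + 1                ≡⟨ cong (λ b → ∣ Z ∣ + bit b) (sym u∈X) ⟩
    ∣ Z ∣ + bit (lookup X u) ≡⟨ ∣p[i]≔b∣ X u false ⟩
    ∣ X ∣ + 0                ∎)
    where
    open ≡-Reasoning
    Z = X [ u ]≔ false
    Y = Z [ v ]≔ true
    Zv≡false : lookup Z v ≡ false
    Zv≡false = trans (lookup∘update′ (in≢out {X = X} u∈X v∉X ∘ sym) X false) v∉X

module _ {N} (X : Subset N) where

  private
    moves : Fin N → Fin N → List (Subset N)
    moves u v = if lookup X v then [] else perturb X u v ∷ []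

    movesFrom : Fin N → List (Subset N)
    movesFrom u = if lookup X u then concatMap (moves u) (next u ∷ prev u ∷ []) else []

  perturbations-∣∣ : All (λ Y → ∣ Y ∣ ≡ ∣ X ∣) (perturbations X)
  perturbations-∣∣ = concat⁺ (map⁺ (universal from (allFin N)))
    where
    towards : ∀ {u} → lookup X u ≡ true → ∀ v → All (λ Y → ∣ Y ∣ ≡ ∣ X ∣) (moves u v)
    towards u∈X v with lookup X v in v∉X
    ... | true  = []
    ... | false = ∣perturb∣ {X = X} u∈X v∉X ∷ []
    from : ∀ u → All (λ Y → ∣ Y ∣ ≡ ∣ X ∣) (movesFrom u)
    from u with lookup X u in u∈X
    ... | true  = concat⁺ (map⁺ (universal (towards u∈X) (next u ∷ prev u ∷ [])))
    ... | false = []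

  perturb∈perturbations : ∀ {u v} → v ∈ next u ∷ prev u ∷ [] →
                          lookup X u ≡ true → lookup X v ≡ false → perturb X u v ∈ perturbations X
  perturb∈perturbations {u} {v} v∈nbrs u∈X v∉X = ∈-concatMap⁺ movesFrom (Any.map (λ { refl → from-u }) (∈-allFin u))
    where
    from-u : perturb X u v ∈ movesFrom u
    from-u rewrite u∈X = ∈-concatMap⁺ (moves u) (Any.map (λ { refl → towards-v }) v∈nbrs)
      where
      towards-v : perturb X u v ∈ moves u v
      towards-v rewrite v∉X = here refl

ALS-preserves-∣∣ : ∀ {N} {F : Subset N → ℕ} {X R} → ALS F X R → ∣ R ∣ ≡ ∣ X ∣
ALS-preserves-∣∣ (stop _) = refl
ALS-preserves-∣∣ {X = X} (step pre post L≡ _ _ run) =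
  trans (ALS-preserves-∣∣ run) (All.lookup (perturbations-∣∣ X) (subst (_ ∈_) (sym L≡) (∈-++⁺ʳ pre (here refl))))

ALS-result-locally-maximal : ∀ {N} {F : Subset N → ℕ} {X R} → ALS F X R → All (λ Y → F Y ≤ F R) (perturbations R)
ALS-result-locally-maximal (stop local-max)     = local-max
ALS-result-locally-maximal (step _ _ _ _ _ run) = ALS-result-locally-maximal run

ALS-terminates : ∀ {N} (F : Subset N → ℕ) bound → (∀ X → F X ≤ bound) → ∀ X → ∃ (ALS F X)
ALS-terminates F bound F≤bound X = climb (suc (bound ∸ F X)) X ≤-refl
  where
  climb : ∀ fuel X → bound ∸ F X < fuel → ∃ (ALS F X)
  climb zero       X ()
  climb (suc fuel) X gap<fuel with first (λ Y → ≤-<-connex (F Y) (F X)) (perturbations X)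
  ... | inj₂ none-better = X , stop none-better
  ... | inj₁ some-better = ascend (toView some-better) refl
    where
    ascend : ∀ {L} → FirstView (λ Y → F Y ≤ F X) (λ Y → F X < F Y) L → L ≡ perturbations X → ∃ (ALS F X)
    ascend (_++_∷_ {xs = pre} {y = Y} not-better better post) L≡
      with climb fuel Y (<-≤-trans (∸-monoʳ-< better (F≤bound Y)) (≤-pred gap<fuel))
    ... | R , run = R , step pre post (sym L≡) not-better better run

pair-term : ∀ {N} → Subset N → Fin N → Fin N → ℕ
pair-term X u v = if lookup X u ∧ lookup X v ∧ ⌊ u F.<? v ⌋ then dist u v else 0

W≤N³ : ∀ {N} (X : Subset N) → W X ≤ N * (N * N)
W≤N³ {N} X = sum-map-allFin-≤ (λ u → sum (map (pair-term X u) (allFin N))) λ u → sum-map-allFin-≤ (pair-term X u) (term≤N u)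
  where
  term≤N : ∀ u v → pair-term X u v ≤ N
  term≤N u v with lookup X u ∧ lookup X v ∧ ⌊ u F.<? v ⌋
  ... | true  = ≤-trans (m⊓n≤n _ _) (m∸n≤m N ∣ toℕ u - toℕ v ∣)
  ... | false = z≤n

dist-sym : ∀ {N} (u v : Fin N) → dist u v ≡ dist v u
dist-sym {N} u v = cong (cycLen N) (∣-∣-comm (toℕ u) (toℕ v))

dist-self : ∀ {N} (u : Fin N) → dist u u ≡ 0
dist-self {N} u = cong (cycLen N) (∣n-n∣≡0 (toℕ u))

pair-term-sym : ∀ {N} (X : Subset N) u v → pair-term X u v + pair-term X v u ≡ bit (lookup X u) * bit (lookup X v) * dist u v
pair-term-sym X u v with lookup X u | lookup X v
... | false | false = refl
... | false | true  = refl
... | true  | false = refl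
... | true  | true  with u F.<? v | v F.<? u
...   | yes u<v | yes v<u = contradiction u<v (<⇒≯ v<u)
...   | yes _   | no  _   = refl
...   | no  _   | yes _   = trans (dist-sym v u) (sym (+-identityʳ (dist u v)))
...   | no  u≮v | no  v≮u rewrite toℕ-injective (≤-antisym (≮⇒≥ v≮u) (≮⇒≥ u≮v)) =
  sym (trans (+-identityʳ (dist v v)) (dist-self v))

-- Windows of a periodic 0/1 sequence

module Windows (n : ℕ) (x : ℕ → ℕ) (x≤1 : ∀ i → x i ≤ 1) (x-periodic : ∀ i → x (i + n) ≡ x i) where

  s r : ℕ
  s = ⌈ n /2⌉
  r = ⌊ n /2⌋

  s+r≡n : s + r ≡ n
  s+r≡n = trans (+-comm s r) (⌊n/2⌋+⌈n/2⌉≡n n)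

  window : ℕ → ℕ
  window t = ∑[ j < s ] x (t + j)

  total : ℕ
  total = ∑ n x

  ∑-period : ∀ t → ∑[ j < n ] x (t + j) ≡ total
  ∑-period = ∑-rotate n x x-periodic

  window-periodic : ∀ t → window (t + n) ≡ window t
  window-periodic t = ∑-cong s λ j _ → trans (cong x (xy+z≡xz+y t n j)) (x-periodic (t + j))

  window-slide : ∀ t → window (suc t) + x t ≡ window t + x (t + s)
  window-slide t = begin
    ∑[ j < s ] x (suc t + j) + x t       ≡⟨ cong₂ _+_ (∑-cong s λ j _ → cong x (sym (+-suc t j))) (cong x (sym (+-identityʳ t))) ⟩
    ∑[ j < s ] x (t + suc j) + x (t + 0) ≡⟨ ∑-shift s (λ j → x (t + j)) ⟩
    window t + x (t + s)                 ∎
    where open ≡-Reasoning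

  opposite-slide : ∀ t → window (suc t + r) + x (t + r) ≡ window (t + r) + x t
  opposite-slide t = trans (window-slide (t + r)) (cong (λ i → window (t + r) + i) (trans (cong x t+r+s≡t+n) (x-periodic t)))
    where
    t+r+s≡t+n : t + r + s ≡ t + n
    t+r+s≡t+n = trans (+-assoc t r s) (cong (t +_) (trans (+-comm r s) s+r≡n))

  window-const : ∀ t c → (∀ j → j < s → x (t + j) ≡ c) → window t ≡ s * c
  window-const t c const = trans (∑-cong s const) (∑-const s c)

  Heavy : ℕ → Set
  Heavy t = window (t + r) + 2 ≤ window t

  module _ (left-stable : ∀ q → x q ≡ 0 → x (suc q) ≡ 1 → ¬ Heavy (suc q)) where

    private
      heavy-gap-forward : ∀ t → Heavy t × x t ≡ 0 → Heavy (suc t) × x (suc t) ≡ 0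
      heavy-gap-forward t (heavy , xt≡0) = heavy′ , xt+1≡0
        where
        opposite-shrinks : window (suc t + r) ≤ window (t + r)
        opposite-shrinks = m+o≡n+p∧p≤o⇒m≤n (trans (opposite-slide t) (cong (window (t + r) +_) xt≡0)) z≤n
        window-grows : window t ≤ window (suc t)
        window-grows = m+o≡n+p∧p≤o⇒m≤n (trans (sym (window-slide t)) (cong (window (suc t) +_) xt≡0)) z≤n
        heavy′ : Heavy (suc t)
        heavy′ = ≤-trans (+-monoˡ-≤ 2 opposite-shrinks) (≤-trans heavy window-grows)
        xt+1≡0 : x (suc t) ≡ 0
        xt+1≡0 with n≤1⇒n≡0∨n≡1 (x≤1 (suc t))
        ... | inj₁ ≡0 = ≡0
        ... | inj₂ ≡1 = contradiction heavy′ (left-stable t xt≡0 ≡1)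

      heavy-run-backward : ∀ t → Heavy (suc t) × x (suc t) ≡ 1 → Heavy t × x t ≡ 1
      heavy-run-backward t (heavy , xt+1≡1) = heavy′ , xt≡1
        where
        xt≡1 : x t ≡ 1
        xt≡1 with n≤1⇒n≡0∨n≡1 (x≤1 t)
        ... | inj₁ ≡0 = contradiction heavy (left-stable t ≡0 xt+1≡1)
        ... | inj₂ ≡1 = ≡1
        opposite-grows : window (t + r) ≤ window (suc t + r)
        opposite-grows = m+o≡n+p∧p≤o⇒m≤n (trans (cong (window (t + r) +_) (sym xt≡1)) (sym (opposite-slide t))) (x≤1 (t + r))
        window-shrinks : window (suc t) ≤ window t
        window-shrinks = m+o≡n+p∧p≤o⇒m≤n (trans (cong (window (suc t) +_) (sym xt≡1)) (window-slide t)) (x≤1 (t + s))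
        heavy′ : Heavy t
        heavy′ = ≤-trans (+-monoˡ-≤ 2 opposite-grows) (≤-trans heavy window-shrinks)

    -- A heavy window stays heavy when moved forward across a 0 or backward across a 1,
    -- so it would sweep a whole period consisting of 0s only or of 1s only.
    no-heavy-window : ∀ t → ¬ Heavy t
    no-heavy-window t heavy with n≤1⇒n≡0∨n≡1 (x≤1 t)
    ... | inj₁ xt≡0 = contradiction (subst (2 ≤_) window≡0 (≤-trans (m≤n+m 2 _) heavy)) λ ()
      where
      window≡0 : window t ≡ 0
      window≡0 = trans (window-const t 0 λ j _ →
          proj₂ (upward-closed (λ i → Heavy i × x i ≡ 0) heavy-gap-forward (m≤m+n t j) (heavy , xt≡0)))
        (*-zeroʳ s)
    ... | inj₂ xt≡1 = m+1+n≰m s (begin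
      s + 2              ≡⟨ cong (_+ 2) (sym (window-full r (≤-reflexive (⌊n/2⌋+⌈n/2⌉≡n n)))) ⟩
      window (t + r) + 2 ≤⟨ heavy ⟩
      window t           ≡⟨ trans (cong window (sym (+-identityʳ t))) (window-full 0 (⌈n/2⌉≤n n)) ⟩
      s                  ∎)
      where
      open ≤-Reasoning
      heavy-t+n : Heavy (t + n)
      heavy-t+n = subst₂ (λ a b → a + 2 ≤ b)
        (sym (trans (cong window (xy+z≡xz+y t n r)) (window-periodic (t + r)))) (sym (window-periodic t)) heavy
      full : ∀ j → j ≤ n → x (t + j) ≡ 1
      full j j≤n = proj₂ (downward-closed (λ i → Heavy i × x i ≡ 1) heavy-run-backward (+-monoʳ-≤ t j≤n)
        (heavy-t+n , trans (x-periodic t) xt≡1))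
      window-full : ∀ a → a + s ≤ n → window (t + a) ≡ s
      window-full a a+s≤n = trans (window-const (t + a) 1 λ j j<s →
          trans (cong x (+-assoc t a j)) (full (a + j) (≤-trans (<⇒≤ (+-monoʳ-< a j<s)) a+s≤n)))
        (*-identityʳ s)

  private
    shared : ℕ → ℕ
    shared t = ∑[ j < s ∸ r ] x (t + (r + j))

    shared≤1 : ∀ t → shared t ≤ 1
    shared≤1 t = begin
      shared t            ≤⟨ ∑-mono-≤ (s ∸ r) (λ j _ → x≤1 (t + (r + j))) ⟩
      ∑[ _ < s ∸ r ] 1     ≡⟨ trans (∑-const (s ∸ r) 1) (*-identityʳ (s ∸ r)) ⟩
      s ∸ r                ≤⟨ m≤n+o⇒m∸n≤o s r (subst (s ≤_) (+-comm 1 r) (⌈n/2⌉≤1+⌊n/2⌋ n)) ⟩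
      1                    ∎
      where open ≤-Reasoning

    window+opposite : ∀ t → window t + window (t + r) ≡ total + shared t
    window+opposite t = begin
      window t + window (t + r)
        ≡⟨ cong (λ m → ∑[ j < m ] x (t + j) + window (t + r)) (sym (m+[n∸m]≡n (⌊n/2⌋≤⌈n/2⌉ n))) ⟩
      ∑[ j < r + (s ∸ r) ] x (t + j) + window (t + r)
        ≡⟨ cong (_+ window (t + r)) (∑-split r (s ∸ r) _) ⟩
      ∑[ j < r ] x (t + j) + shared t + window (t + r)
        ≡⟨ xy+z≡xz+y (∑[ j < r ] x (t + j)) (shared t) _ ⟩
      ∑[ j < r ] x (t + j) + window (t + r) + shared t
        ≡⟨ cong (λ w → ∑[ j < r ] x (t + j) + w + shared t) (∑-cong s (λ j _ → cong x (+-assoc t r j))) ⟩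
      ∑[ j < r ] x (t + j) + ∑[ j < s ] x (t + (r + j)) + shared t
        ≡⟨ cong (_+ shared t) (sym (∑-split r s _)) ⟩
      ∑[ j < r + s ] x (t + j) + shared t
        ≡⟨ cong (λ m → ∑[ j < m ] x (t + j) + shared t) (⌊n/2⌋+⌈n/2⌉≡n n) ⟩
      ∑[ j < n ] x (t + j) + shared t
        ≡⟨ cong (_+ shared t) (∑-period t) ⟩
      total + shared t
        ∎
      where open ≡-Reasoning

  total≤window+opposite : ∀ t → total ≤ window t + window (t + r)
  total≤window+opposite t = subst (total ≤_) (sym (window+opposite t)) (m≤m+n total (shared t))

  window+opposite≤1+total : ∀ t → window t + window (t + r) ≤ suc total
  window+opposite≤1+total t = subst (_≤ suc total) (sym (window+opposite t))
    (subst (total + shared t ≤_) (+-comm total 1) (+-monoʳ-≤ total (shared≤1 t)))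

  outside : ℕ → ℕ
  outside t = ∑[ j < r ] x (t + (s + j))

  window+outside : ∀ t → window t + outside t ≡ total
  window+outside t = begin
    window t + outside t       ≡⟨ sym (∑-split s r (λ j → x (t + j))) ⟩
    ∑[ j < s + r ] x (t + j)   ≡⟨ cong (λ m → ∑[ j < m ] x (t + j)) s+r≡n ⟩
    ∑[ j < n ] x (t + j)       ≡⟨ ∑-period t ⟩
    total                      ∎
    where open ≡-Reasoning

  window≤total : ∀ t → window t ≤ total
  window≤total t = subst (window t ≤_) (window+outside t) (m≤m+n (window t) (outside t))

  ∑-window : ∑[ t < n ] window t ≡ s * total
  ∑-window = begin
    ∑[ t < n ] ∑[ j < s ] x (t + j) ≡⟨ ∑-comm n s _ ⟩
    ∑[ j < s ] ∑[ t < n ] x (t + j) ≡⟨ ∑-cong s (λ j _ → trans (∑-cong n λ t _ → cong x (+-comm t j)) (∑-period j)) ⟩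
    ∑[ j < s ] total                ≡⟨ ∑-const s total ⟩
    s * total                       ∎
    where open ≡-Reasoning

  correlation : ℕ → ℕ
  correlation δ = ∑[ i < n ] x i * x (i + δ)

  private
    ∑-pair-at-offset : ∀ i j → i < s → ∑[ t < n ] x (t + i) * x (t + (s + j)) ≡ correlation (suc (s ∸ suc i + j))
    ∑-pair-at-offset i j i<s = begin
      ∑[ t < n ] x (t + i) * x (t + (s + j)) ≡⟨ ∑-cong n (λ t _ → pair t) ⟩
      ∑[ t < n ] g (i + t)                   ≡⟨ ∑-rotate n g g-periodic i ⟩
      correlation (s ∸ i + j)                ≡⟨ cong (λ m → correlation (m + j)) (+-∸-assoc 1 i<s) ⟩
      correlation (suc (s ∸ suc i + j))      ∎
      where
      open ≡-Reasoning
      i≤s = <⇒≤ i<s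
      e = s ∸ i + j
      g : ℕ → ℕ
      g t = x t * x (t + e)
      regroup : ∀ a t d j → a + t + (d + j) ≡ t + ((a + d) + j)
      regroup = solve-∀
      pair : ∀ t → x (t + i) * x (t + (s + j)) ≡ g (i + t)
      pair t = cong₂ _*_ (cong x (+-comm t i))
        (cong x (sym (trans (regroup i t (s ∸ i) j) (cong (λ m → t + (m + j)) (m+[n∸m]≡n i≤s)))))
      g-periodic : ∀ t → g (t + n) ≡ g t
      g-periodic t = cong₂ _*_ (x-periodic t) (trans (cong x (xy+z≡xz+y t n e)) (x-periodic (t + e)))

  ∑-window*outside : ∑[ t < n ] window t * outside t ≡ ∑[ δ < n ] cycLen n δ * correlation δ
  ∑-window*outside = begin
    ∑[ t < n ] window t * outside t
      ≡⟨ ∑-cong n (λ t _ → trans (*-distribʳ-∑ s (outside t) _) (∑-cong s λ i _ → *-distribˡ-∑ r (x (t + i)) _)) ⟩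
    ∑[ t < n ] ∑[ i < s ] ∑[ j < r ] x (t + i) * x (t + (s + j))
      ≡⟨ ∑-comm n s _ ⟩
    ∑[ i < s ] ∑[ t < n ] ∑[ j < r ] x (t + i) * x (t + (s + j))
      ≡⟨ ∑-cong s (λ i _ → ∑-comm n r _) ⟩
    ∑[ i < s ] ∑[ j < r ] ∑[ t < n ] x (t + i) * x (t + (s + j))
      ≡⟨ ∑-cong s (λ i i<s → ∑-cong r λ j _ → ∑-pair-at-offset i j i<s) ⟩
    ∑[ i < s ] ∑[ j < r ] correlation (suc (s ∸ suc i + j))
      ≡⟨ ∑-reverse s (λ a → ∑[ j < r ] correlation (suc (a + j))) ⟩
    ∑[ a < s ] ∑[ j < r ] correlation (suc (a + j))
      ≡⟨ ∑-window-offsets n correlation ⟩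
    ∑[ δ < n ] cycLen n δ * correlation δ
      ∎
    where open ≡-Reasoning

module BalancedWindows (n : ℕ) (x : ℕ → ℕ) (x≤1 : ∀ i → x i ≤ 1) (x-periodic : ∀ i → x (i + n) ≡ x i) where
  open Windows n x x≤1 x-periodic public

  Light : ℕ → Set
  Light t = window t + 2 ≤ window (t + r)

  -- Complementing x exchanges heavy and light windows, and left and right moves.
  private
    module Complement = Windows n (λ i → 1 ∸ x i) (λ i → m∸n≤m 1 (x i)) (λ i → cong (1 ∸_) (x-periodic i))

    complement+window : ∀ t → Complement.window t + window t ≡ s
    complement+window t = begin
      Complement.window t + window t   ≡⟨ sym (∑-distrib-+ s _ _) ⟩
      ∑[ j < s ] (1 ∸ x (t + j) + x (t + j)) ≡⟨ ∑-cong s (λ j _ → m∸n+n≡m (x≤1 (t + j))) ⟩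
      ∑[ _ < s ] 1                     ≡⟨ trans (∑-const s 1) (*-identityʳ s) ⟩
      s                                ∎
      where open ≡-Reasoning

    light⇒complement-heavy : ∀ {t} → Light t → Complement.Heavy t
    light⇒complement-heavy {t} = complement-flip (complement+window t) (complement+window (t + r))

    complement-heavy⇒light : ∀ {t} → Complement.Heavy t → Light t
    complement-heavy⇒light {t} = complement-flip
      (trans (+-comm (window (t + r)) _) (complement+window (t + r))) (trans (+-comm (window t) _) (complement+window t))

    1∸y≡0⇒y≡1 : ∀ {y} → y ≤ 1 → 1 ∸ y ≡ 0 → y ≡ 1
    1∸y≡0⇒y≡1 z≤n       ()
    1∸y≡0⇒y≡1 (s≤s z≤n) _ = refl

    1∸y≡1⇒y≡0 : ∀ {y} → y ≤ 1 → 1 ∸ y ≡ 1 → y ≡ 0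
    1∸y≡1⇒y≡0 z≤n       _ = refl
    1∸y≡1⇒y≡0 (s≤s z≤n) ()

  no-light-window : (∀ q → x q ≡ 1 → x (suc q) ≡ 0 → ¬ Light (suc q)) → ∀ t → ¬ Light t
  no-light-window right-stable t = Complement.no-heavy-window complement-stable t ∘ light⇒complement-heavy
    where
    complement-stable : ∀ q → 1 ∸ x q ≡ 0 → 1 ∸ x (suc q) ≡ 1 → ¬ Complement.Heavy (suc q)
    complement-stable q xq xq+1 = right-stable q (1∸y≡0⇒y≡1 (x≤1 q) xq) (1∸y≡1⇒y≡0 (x≤1 (suc q)) xq+1) ∘ complement-heavy⇒light

  windows-balanced : (∀ t → ¬ Heavy t) → (∀ t → ¬ Light t) → ∀ t → ⌊ total /2⌋ ≤ window t × window t ≤ suc ⌊ total /2⌋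
  windows-balanced no-heavy no-light t = m+m≤1+n+n⇒m≤n lower , m+m≤1+n+n⇒m≤n upper
    where
    h = ⌊ total /2⌋
    w = window t
    w′ = window (t + r)
    w≤w′+1 : w ≤ w′ + 1
    w≤w′+1 = ≤-pred (subst (w <_) (+-suc w′ 1) (≰⇒> (no-heavy t)))
    w′≤w+1 : w′ ≤ w + 1
    w′≤w+1 = ≤-pred (subst (w′ <_) (+-suc w 1) (≰⇒> (no-light t)))
    lower : h + h ≤ suc (w + w)
    lower = begin
      h + h          ≤⟨ ⌊n/2⌋+⌊n/2⌋≤n total ⟩
      total          ≤⟨ total≤window+opposite t ⟩
      w + w′         ≤⟨ +-monoʳ-≤ w w′≤w+1 ⟩
      w + (w + 1)    ≡⟨ trans (sym (+-assoc w w 1)) (+-comm (w + w) 1) ⟩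
      suc (w + w)    ∎
      where open ≤-Reasoning
    upper : w + w ≤ suc (suc h + suc h)
    upper = begin
      w + w          ≤⟨ +-monoʳ-≤ w w≤w′+1 ⟩
      w + (w′ + 1)   ≡⟨ sym (+-assoc w w′ 1) ⟩
      w + w′ + 1     ≤⟨ +-monoˡ-≤ 1 (window+opposite≤1+total t) ⟩
      suc total + 1  ≤⟨ +-monoˡ-≤ 1 (s≤s (n≤1+⌊n/2⌋+⌊n/2⌋ total)) ⟩
      suc (suc (h + h)) + 1 ≡⟨ regroup h ⟩
      suc (suc h + suc h) ∎
      where
      open ≤-Reasoning
      regroup : ∀ h → suc (suc (h + h)) + 1 ≡ suc (suc h + suc h)
      regroup = solve-∀

-- The cycle C_n

mod-offset : ∀ {n w j} .{{_ : NonZero n}} → w < n → j < n → (w + j) % n ≡ w → j ≡ 0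
mod-offset {n} {w} {j} w<n j<n eq with w + j <? n
... | yes w+j<n = +-cancelˡ-≡ w j 0 (trans (trans (sym (m<n⇒m%n≡m w+j<n)) eq) (sym (+-identityʳ w)))
... | no  w+j≮n = contradiction (+-cancelˡ-≡ w j n (trans (sym (m∸n+n≡m n≤w+j)) (cong (_+ n) wrapped))) (<⇒≢ j<n)
  where
  n≤w+j : n ≤ w + j
  n≤w+j = ≮⇒≥ w+j≮n
  wrapped : w + j ∸ n ≡ w
  wrapped = begin
    w + j ∸ n         ≡⟨ sym (m<n⇒m%n≡m (m<n+o⇒m∸n<o (w + j) n (+-mono-< w<n j<n))) ⟩
    (w + j ∸ n) % n   ≡⟨ m≤n⇒[n∸m]%m≡n%m n≤w+j ⟩
    (w + j) % n       ≡⟨ eq ⟩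
    w                 ∎
    where open ≡-Reasoning

-- Indexing by k = n - 2 makes ⌊ n /2⌋ and ⌈ n /2⌉ visibly positive.
module Cycle (k : ℕ) where

  n : ℕ
  n = suc (suc k)

  toFin : ℕ → Fin n
  toFin i = fromℕ< (m%n<n i n)

  toℕ-toFin : ∀ i → toℕ (toFin i) ≡ i % n
  toℕ-toFin i = toℕ-fromℕ< (m%n<n i n)

  toℕ-toFin-< : ∀ {i} → i < n → toℕ (toFin i) ≡ i
  toℕ-toFin-< {i} i<n = trans (toℕ-toFin i) (m<n⇒m%n≡m i<n)

  toFin-cong : ∀ {i j} → i % n ≡ j % n → toFin i ≡ toFin j
  toFin-cong {i} {j} eq = toℕ-injective (trans (toℕ-toFin i) (trans eq (sym (toℕ-toFin j))))

  toFin-toℕ : ∀ u → toFin (toℕ u) ≡ u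
  toFin-toℕ u = toℕ-injective (toℕ-toFin-< (toℕ<n u))

  toFin-periodic : ∀ i → toFin (i + n) ≡ toFin i
  toFin-periodic i = toFin-cong {i + n} {i} ([m+n]%n≡m%n i n)

  [i%n+j]%n≡[i+j]%n : ∀ i j → (i % n + j) % n ≡ (i + j) % n
  [i%n+j]%n≡[i+j]%n i j = begin
    (i % n + j) % n         ≡⟨ %-distribˡ-+ (i % n) j n ⟩
    (i % n % n + j % n) % n ≡⟨ cong (λ m → (m + j % n) % n) (m%n%n≡m%n i n) ⟩
    (i % n + j % n) % n     ≡⟨ sym (%-distribˡ-+ i j n) ⟩
    (i + j) % n             ∎
    where open ≡-Reasoning

  toFin-+ : ∀ i j → toFin (toℕ (toFin i) + j) ≡ toFin (i + j)
  toFin-+ i j = toFin-cong {toℕ (toFin i) + j} {i + j} (trans (cong (λ m → (m + j) % n) (toℕ-toFin i)) ([i%n+j]%n≡[i+j]%n i j))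

  next-toFin : ∀ i → next (toFin i) ≡ toFin (suc i)
  next-toFin i = trans (cong toFin (+-comm 1 (toℕ (toFin i)))) (trans (toFin-+ i 1) (cong toFin (+-comm i 1)))

  prev-toFin-suc : ∀ i → prev (toFin (suc i)) ≡ toFin i
  prev-toFin-suc i = trans (toFin-+ (suc i) (suc k)) (trans (cong toFin (sym (+-suc i (suc k)))) (toFin-periodic i))

  private
    reduced : ∀ p j → toFin (p + j) ≡ toFin p → (p % n + j) % n ≡ p % n
    reduced p j eq = trans ([i%n+j]%n≡[i+j]%n p j) (trans (sym (toℕ-toFin (p + j))) (trans (cong toℕ eq) (toℕ-toFin p)))

  toFin-offset : ∀ p j → toFin (p + j) ≡ toFin p → j < n + n → j ≡ 0 ⊎ j ≡ n
  toFin-offset p j eq j<2n with j <? n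
  ... | yes j<n = inj₁ (mod-offset (m%n<n p n) j<n (reduced p j eq))
  ... | no  j≮n = inj₂ (trans (sym (m∸n+n≡m (≮⇒≥ j≮n))) (cong (_+ n) (mod-offset (m%n<n p n) j∸n<n (reduced p (j ∸ n) eq′))))
    where
    j∸n<n : j ∸ n < n
    j∸n<n = m<n+o⇒m∸n<o j n j<2n
    eq′ : toFin (p + (j ∸ n)) ≡ toFin p
    eq′ = trans (sym (toFin-periodic (p + (j ∸ n))))
            (trans (cong toFin (trans (+-assoc p (j ∸ n) n) (cong (p +_) (m∸n+n≡m (≮⇒≥ j≮n))))) eq)

  x : Subset n → ℕ → ℕ
  x X i = bit (lookup X (toFin i))

  x-periodic : ∀ X i → x X (i + n) ≡ x X i
  x-periodic X i = cong (bit ∘ lookup X) (toFin-periodic i)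

  s r : ℕ
  s = ⌈ n /2⌉
  r = ⌊ n /2⌋

  module WindowsOf (X : Subset n) = BalancedWindows n (x X) (λ i → bit≤1 _) (x-periodic X)
  open WindowsOf hiding (s; r)

  ∣X∣≡total : ∀ X → ∣ X ∣ ≡ total X
  ∣X∣≡total X = ∣p∣≡∑ X (x X) (λ u → cong (bit ∘ lookup X) (toFin-toℕ u))

  window≤∣X∣ : ∀ X t → window X t ≤ ∣ X ∣
  window≤∣X∣ X t = subst (window X t ≤_) (sym (∣X∣≡total X)) (window≤total X t)

  distℕ : ℕ → ℕ → ℕ
  distℕ i j = dist (toFin i) (toFin j)

  distℕ-offset : ∀ {i δ} → i < n → δ < n → distℕ i (i + δ) ≡ cycLen n δ
  distℕ-offset {i} {δ} i<n δ<n with i + δ <? n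
  ... | yes i+δ<n = cong (cycLen n) (begin
    ∣ toℕ (toFin i) - toℕ (toFin (i + δ)) ∣ ≡⟨ cong₂ ∣_-_∣ (toℕ-toFin-< i<n) (toℕ-toFin-< i+δ<n) ⟩
    ∣ i - (i + δ) ∣                          ≡⟨ m≤n⇒∣m-n∣≡n∸m (m≤m+n i δ) ⟩
    i + δ ∸ i                                ≡⟨ m+n∸m≡n i δ ⟩
    δ                                        ∎)
    where open ≡-Reasoning
  ... | no  i+δ≮n = trans (cong (cycLen n) (begin
    ∣ toℕ (toFin i) - toℕ (toFin (i + δ)) ∣ ≡⟨ cong₂ ∣_-_∣ (toℕ-toFin-< i<n) wrapped ⟩
    ∣ i - (i + δ ∸ n) ∣                      ≡⟨ m≤n⇒∣n-m∣≡n∸m e≤i ⟩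
    i ∸ (i + δ ∸ n)                          ≡⟨ m+n≡o⇒o∸m≡n (+-cancelʳ-≡ δ _ _ e+[n∸δ]+δ≡i+δ) ⟩
    n ∸ δ                                    ∎)) (cycLen-reflect (<⇒≤ δ<n))
    where
    open ≡-Reasoning
    n≤i+δ : n ≤ i + δ
    n≤i+δ = ≮⇒≥ i+δ≮n
    wrapped : toℕ (toFin (i + δ)) ≡ i + δ ∸ n
    wrapped = trans (toℕ-toFin (i + δ)) (trans (sym (m≤n⇒[n∸m]%m≡n%m n≤i+δ)) (m<n⇒m%n≡m (m<n+o⇒m∸n<o (i + δ) n (+-mono-< i<n δ<n))))
    e≤i : i + δ ∸ n ≤ i
    e≤i = m≤n+o⇒m∸n≤o (i + δ) n (subst (i + δ ≤_) (+-comm i n) (+-monoʳ-≤ i (<⇒≤ δ<n)))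
    e+[n∸δ]+δ≡i+δ : i + δ ∸ n + (n ∸ δ) + δ ≡ i + δ
    e+[n∸δ]+δ≡i+δ = trans (+-assoc (i + δ ∸ n) (n ∸ δ) δ) (trans (cong (i + δ ∸ n +_) (m∸n+n≡m (<⇒≤ δ<n))) (m∸n+n≡m n≤i+δ))

  ordered-pair : Subset n → ℕ → ℕ → ℕ
  ordered-pair X i j = pair-term X (toFin i) (toFin j)

  W≡∑∑ordered-pair : ∀ X → W X ≡ ∑[ i < n ] ∑[ j < n ] ordered-pair X i j
  W≡∑∑ordered-pair X =
    sum-map-allFin (λ u → sum (map (pair-term X u) (allFin n))) (λ i → ∑ n (ordered-pair X i)) λ u →
    sum-map-allFin (pair-term X u) (ordered-pair X (toℕ u)) λ v →
    cong₂ (pair-term X) (sym (toFin-toℕ u)) (sym (toFin-toℕ v))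

  W+W≡∑∑pair : ∀ X → W X + W X ≡ ∑[ i < n ] ∑[ j < n ] x X i * x X j * distℕ i j
  W+W≡∑∑pair X = begin
    W X + W X
      ≡⟨ cong₂ _+_ (W≡∑∑ordered-pair X) (trans (W≡∑∑ordered-pair X) (∑-comm n n (ordered-pair X))) ⟩
    ∑[ i < n ] ∑[ j < n ] ordered-pair X i j + ∑[ i < n ] ∑[ j < n ] ordered-pair X j i
      ≡⟨ sym (∑-distrib-+ n (λ i → ∑[ j < n ] ordered-pair X i j) (λ i → ∑[ j < n ] ordered-pair X j i)) ⟩
    ∑[ i < n ] (∑[ j < n ] ordered-pair X i j + ∑[ j < n ] ordered-pair X j i)
      ≡⟨ ∑-cong n (λ i _ → sym (∑-distrib-+ n (ordered-pair X i) (λ j → ordered-pair X j i))) ⟩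
    ∑[ i < n ] ∑[ j < n ] (ordered-pair X i j + ordered-pair X j i)
      ≡⟨ ∑-cong n (λ i _ → ∑-cong n λ j _ → pair-term-sym X (toFin i) (toFin j)) ⟩
    ∑[ i < n ] ∑[ j < n ] x X i * x X j * distℕ i j
      ∎
    where open ≡-Reasoning

  W+W≡∑cycLen*correlation : ∀ X → W X + W X ≡ ∑[ δ < n ] cycLen n δ * correlation X δ
  W+W≡∑cycLen*correlation X = begin
    W X + W X
      ≡⟨ W+W≡∑∑pair X ⟩
    ∑[ i < n ] ∑[ j < n ] x X i * x X j * distℕ i j
      ≡⟨ ∑-cong n from-i ⟩
    ∑[ i < n ] ∑[ δ < n ] x X i * (x X (i + δ) * cycLen n δ)
      ≡⟨ ∑-comm n n (λ i δ → x X i * (x X (i + δ) * cycLen n δ)) ⟩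
    ∑[ δ < n ] ∑[ i < n ] x X i * (x X (i + δ) * cycLen n δ)
      ≡⟨ ∑-cong n (λ δ _ → trans (∑-cong n λ i _ → rotate-factors (x X i) (x X (i + δ)) (cycLen n δ))
                                  (sym (*-distribˡ-∑ n (cycLen n δ) (λ i → x X i * x X (i + δ))))) ⟩
    ∑[ δ < n ] cycLen n δ * correlation X δ
      ∎
    where
    open ≡-Reasoning
    rotate-factors : ∀ a b c → a * (b * c) ≡ c * (a * b)
    rotate-factors = solve-∀
    from-i : ∀ i → i < n → ∑[ j < n ] x X i * x X j * distℕ i j ≡ ∑[ δ < n ] x X i * (x X (i + δ) * cycLen n δ)
    from-i i i<n = begin
      ∑[ j < n ] x X i * x X j * distℕ i j            ≡⟨ ∑-cong n (λ j _ → *-assoc (x X i) (x X j) (distℕ i j)) ⟩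
      ∑[ j < n ] x X i * (x X j * distℕ i j)          ≡⟨ sym (*-distribˡ-∑ n (x X i) (λ j → x X j * distℕ i j)) ⟩
      x X i * (∑[ j < n ] x X j * distℕ i j)          ≡⟨ cong (x X i *_) (sym (∑-rotate n (λ j → x X j * distℕ i j) summand-periodic i)) ⟩
      x X i * (∑[ δ < n ] x X (i + δ) * distℕ i (i + δ)) ≡⟨ cong (x X i *_) (∑-cong n λ δ δ<n → cong (x X (i + δ) *_) (distℕ-offset i<n δ<n)) ⟩
      x X i * (∑[ δ < n ] x X (i + δ) * cycLen n δ)   ≡⟨ *-distribˡ-∑ n (x X i) (λ δ → x X (i + δ) * cycLen n δ) ⟩
      ∑[ δ < n ] x X i * (x X (i + δ) * cycLen n δ)   ∎
      where
      summand-periodic : ∀ j → x X (j + n) * distℕ i (j + n) ≡ x X j * distℕ i j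
      summand-periodic j = cong₂ _*_ (x-periodic X j) (cong (dist (toFin i)) (toFin-periodic j))

  W-window-formula : ∀ X → W X + W X ≡ ∑[ t < n ] cut ∣ X ∣ (window X t)
  W-window-formula X = begin
    W X + W X                                   ≡⟨ W+W≡∑cycLen*correlation X ⟩
    ∑[ δ < n ] cycLen n δ * correlation X δ     ≡⟨ sym (∑-window*outside X) ⟩
    ∑[ t < n ] window X t * outside X t         ≡⟨ ∑-cong n (λ t _ → cong (window X t *_) (outside≡∣X∣∸window t)) ⟩
    ∑[ t < n ] cut ∣ X ∣ (window X t)           ∎
    where
    open ≡-Reasoning
    outside≡∣X∣∸window : ∀ t → outside X t ≡ ∣ X ∣ ∸ window X t
    outside≡∣X∣∸window t = sym (m+n≡o⇒o∸m≡n {window X t} (trans (window+outside X t) (sym (∣X∣≡total X))))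

  δ : ℕ → ℕ → ℕ
  δ p i = bit ⌊ toFin i F.≟ toFin p ⌋

  δ-≡ : ∀ p i → toFin i ≡ toFin p → δ p i ≡ 1
  δ-≡ p i eq with toFin i F.≟ toFin p
  ... | yes _  = refl
  ... | no  ne = contradiction eq ne

  δ-≢ : ∀ p i → toFin i ≢ toFin p → δ p i ≡ 0
  δ-≢ p i ne with toFin i F.≟ toFin p
  ... | yes eq = contradiction eq ne
  ... | no  _  = refl

  δ-suc : ∀ p i → δ (suc p) (suc i) ≡ δ p i
  δ-suc p i with toFin i F.≟ toFin p
  ... | yes eq = δ-≡ (suc p) (suc i) (trans (sym (next-toFin i)) (trans (cong next eq) (next-toFin p)))
  ... | no  ne = δ-≢ (suc p) (suc i) λ eq → ne (trans (sym (prev-toFin-suc i)) (trans (cong prev eq) (prev-toFin-suc p)))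

  δ-offset : ∀ p j → j < n + n → j ≢ 0 → j ≢ n → δ p (p + j) ≡ 0
  δ-offset p j j<2n j≢0 j≢n = δ-≢ p (p + j) λ eq → [ j≢0 , j≢n ] (toFin-offset p j eq j<2n)

  x-perturb : ∀ {X pu pv} → lookup X (toFin pu) ≡ true → lookup X (toFin pv) ≡ false →
              ∀ i → x (perturb X (toFin pu) (toFin pv)) i + δ pu i ≡ x X i + δ pv i
  x-perturb {X} {pu} {pv} u∈X v∉X i with toFin i F.≟ toFin pu | toFin i F.≟ toFin pv
  ... | yes i≡u | yes i≡v = contradiction (trans (sym i≡u) i≡v) (in≢out {X = X} u∈X v∉X)
  ... | yes i≡u | no  _   rewrite i≡u | lookup-perturb-source {X = X} (in≢out {X = X} u∈X v∉X) | u∈X = refl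
  ... | no  _   | yes i≡v rewrite i≡v | lookup-perturb-target {X = X} {toFin pu} {toFin pv} | v∉X = refl
  ... | no  i≢u | no  i≢v = cong (λ b → bit b + 0) (lookup-perturb-other {X = X} i≢u i≢v)

  window-transfer : ∀ {A B} q → (∀ i → x A i + δ (suc q) i ≡ x B i + δ q i) →
                    ∀ t → window A t + δ (suc q) t ≡ window B t + δ (suc q) (t + s)
  window-transfer {A} {B} q moved t = begin
    window A t + δ (suc q) t       ≡⟨ cong (λ i → window A t + δ (suc q) i) (sym (+-identityʳ t)) ⟩
    window A t + δ (suc q) (t + 0) ≡⟨ ∑-telescope s {λ j → x A (t + j)} {λ j → x B (t + j)} {λ j → δ (suc q) (t + j)} balance ⟩
    window B t + δ (suc q) (t + s) ∎
    where
    open ≡-Reasoning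
    balance : ∀ j → x A (t + j) + δ (suc q) (t + j) ≡ x B (t + j) + δ (suc q) (t + suc j)
    balance j = trans (moved (t + j)) (cong (x B (t + j) +_) (trans (sym (δ-suc q (t + j))) (cong (δ (suc q)) (sym (+-suc t j)))))

  module _ {A B : Subset n} (p : ℕ) (transfer : ∀ t → window A t + δ p t ≡ window B t + δ p (t + s)) where

    private
      <2n : ∀ {j} → j < n → j < n + n
      <2n j<n = ≤-trans j<n (m≤m+n n n)

      s<n : s < n
      s<n = ⌈n/2⌉<n k

      r<n : r < n
      r<n = ⌊n/2⌋<n (suc k)

      r+s≡n : r + s ≡ n
      r+s≡n = ⌊n/2⌋+⌈n/2⌉≡n n

    window-source : window A (p + 0) + 1 ≡ window B (p + 0)
    window-source = begin
      window A (p + 0) + 1               ≡⟨ cong (window A (p + 0) +_) (sym (δ-≡ p (p + 0) (cong toFin (+-identityʳ p)))) ⟩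
      window A (p + 0) + δ p (p + 0)     ≡⟨ transfer (p + 0) ⟩
      window B (p + 0) + δ p (p + 0 + s) ≡⟨ cong (λ i → window B (p + 0) + δ p (i + s)) (+-identityʳ p) ⟩
      window B (p + 0) + δ p (p + s)     ≡⟨ cong (window B (p + 0) +_) (δ-offset p s (<2n s<n) (λ ()) (<⇒≢ s<n)) ⟩
      window B (p + 0) + 0               ≡⟨ +-identityʳ (window B (p + 0)) ⟩
      window B (p + 0)                   ∎
      where open ≡-Reasoning

    window-target : window A (p + r) ≡ window B (p + r) + 1
    window-target = begin
      window A (p + r)                   ≡⟨ sym (+-identityʳ (window A (p + r))) ⟩
      window A (p + r) + 0               ≡⟨ cong (window A (p + r) +_) (sym (δ-offset p r (<2n r<n) (λ ()) (<⇒≢ r<n))) ⟩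
      window A (p + r) + δ p (p + r)     ≡⟨ transfer (p + r) ⟩
      window B (p + r) + δ p (p + r + s) ≡⟨ cong (window B (p + r) +_) (δ-≡ p (p + r + s) toFin[p+r+s]≡toFin[p]) ⟩
      window B (p + r) + 1               ∎
      where
      open ≡-Reasoning
      toFin[p+r+s]≡toFin[p] : toFin (p + r + s) ≡ toFin p
      toFin[p+r+s]≡toFin[p] = trans (cong toFin (trans (+-assoc p r s) (cong (p +_) r+s≡n))) (toFin-periodic p)

    window-elsewhere : ∀ j → j < n → j ≢ 0 → j ≢ r → window A (p + j) ≡ window B (p + j)
    window-elsewhere j j<n j≢0 j≢r = +-cancelʳ-≡ 0 _ _ (begin
      window A (p + j) + 0                 ≡⟨ cong (window A (p + j) +_) (sym (δ-offset p j (<2n j<n) j≢0 (<⇒≢ j<n))) ⟩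
      window A (p + j) + δ p (p + j)       ≡⟨ transfer (p + j) ⟩
      window B (p + j) + δ p (p + j + s)   ≡⟨ cong (λ i → window B (p + j) + δ p i) (+-assoc p j s) ⟩
      window B (p + j) + δ p (p + (j + s)) ≡⟨ cong (window B (p + j) +_) (δ-offset p (j + s) (+-mono-< j<n s<n) (m+1+n≢0 j) j+s≢n) ⟩
      window B (p + j) + 0                 ∎)
      where
      open ≡-Reasoning
      j+s≢n : j + s ≢ n
      j+s≢n j+s≡n = j≢r (+-cancelʳ-≡ s j r (trans j+s≡n (sym r+s≡n)))

  transfer-improves : ∀ {X Y} p a b → a < n → b < n → a ≢ b → ∣ Y ∣ ≡ ∣ X ∣ →
    window Y (p + a) + 1 ≡ window X (p + a) → window Y (p + b) ≡ window X (p + b) + 1 →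
    (∀ j → j < n → j ≢ a → j ≢ b → window Y (p + j) ≡ window X (p + j)) →
    window X (p + b) + 2 ≤ window X (p + a) → W X < W Y
  transfer-improves {X} {Y} p a b a<n b<n a≢b ∣Y∣≡∣X∣ source target elsewhere imbalance = m+m<n+n⇒m<n (begin-strict
    W X + W X                                 ≡⟨ W-window-formula X ⟩
    ∑[ t < n ] cut m (window X t)             ≡⟨ sym (∑-rotate n (cut m ∘ window X) (cut-periodic X) p) ⟩
    ∑[ j < n ] cut m (window X (p + j))       <⟨ ∑-<-two-points n a b a<n b<n a≢b (λ j j<n j≢a j≢b → cong (cut m) (sym (elsewhere j j<n j≢a j≢b))) gain ⟩
    ∑[ j < n ] cut m (window Y (p + j))       ≡⟨ ∑-rotate n (cut m ∘ window Y) (cut-periodic Y) p ⟩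
    ∑[ t < n ] cut m (window Y t)             ≡⟨ sym (subst (λ m′ → W Y + W Y ≡ ∑[ t < n ] cut m′ (window Y t)) ∣Y∣≡∣X∣ (W-window-formula Y)) ⟩
    W Y + W Y                                 ∎)
    where
    open ≤-Reasoning
    m = ∣ X ∣
    cut-periodic : ∀ Z t → cut m (window Z (t + n)) ≡ cut m (window Z t)
    cut-periodic Z t = cong (cut m) (window-periodic Z t)
    gain : cut m (window X (p + a)) + cut m (window X (p + b)) < cut m (window Y (p + a)) + cut m (window Y (p + b))
    gain = cut-transfer source target imbalance (window≤∣X∣ X (p + a))

  W-cut-formula : ∀ Z {c} → ∣ Z ∣ ≤ c → W Z + W Z + (c ∸ ∣ Z ∣) * (s * ∣ Z ∣) ≡ ∑[ t < n ] cut c (window Z t)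
  W-cut-formula Z {c} m≤c = begin
    W Z + W Z + d * (s * m)                                 ≡⟨ cong₂ (λ y z → y + d * (s * z)) (W-window-formula Z) (∣X∣≡total Z) ⟩
    ∑[ t < n ] cut m (window Z t) + d * (s * total Z)        ≡⟨ cong (λ y → ∑[ t < n ] cut m (window Z t) + d * y) (sym (∑-window Z)) ⟩
    ∑[ t < n ] cut m (window Z t) + d * (∑[ t < n ] window Z t) ≡⟨ cong (∑[ t < n ] cut m (window Z t) +_) (*-distribˡ-∑ n d (window Z)) ⟩
    ∑[ t < n ] cut m (window Z t) + ∑[ t < n ] d * window Z t ≡⟨ sym (∑-distrib-+ n (λ t → cut m (window Z t)) (λ t → d * window Z t)) ⟩
    ∑[ t < n ] (cut m (window Z t) + d * window Z t)        ≡⟨ ∑-cong n (λ t _ → sym (cut-extend d (window≤∣X∣ Z t))) ⟩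
    ∑[ t < n ] cut (m + d) (window Z t)                     ≡⟨ ∑-cong n (λ t _ → cong (λ c′ → cut c′ (window Z t)) (m+[n∸m]≡n m≤c)) ⟩
    ∑[ t < n ] cut c (window Z t)                           ∎
    where
    open ≡-Reasoning
    m = ∣ Z ∣
    d = c ∸ m

  LocallyMaximal : Subset n → Set
  LocallyMaximal X = All (λ Y → W Y ≤ W X) (perturbations X)

  module _ {X} (local-max : LocallyMaximal X) where

    private
      r≢0 : r ≢ 0
      r≢0 ()

    no-improving-left-move : ∀ q → x X q ≡ 0 → x X (suc q) ≡ 1 → ¬ Heavy X (suc q)
    no-improving-left-move q xq≡0 xq+1≡1 heavy = contradiction (All.lookup local-max Y∈perturbations) (<⇒≱ improves)
      where
      u∈X = bit≡1⇒true xq+1≡1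
      v∉X = bit≡0⇒false xq≡0
      Y = perturb X (toFin (suc q)) (toFin q)
      Y∈perturbations : Y ∈ perturbations X
      Y∈perturbations = perturb∈perturbations X (there (here (sym (prev-toFin-suc q)))) u∈X v∉X
      transfer = window-transfer {Y} {X} q (x-perturb {X} {suc q} {q} u∈X v∉X)
      improves : W X < W Y
      improves = transfer-improves {X} {Y} (suc q) 0 r (s≤s z≤n) (⌊n/2⌋<n (suc k)) (r≢0 ∘ sym) (∣perturb∣ {X = X} u∈X v∉X)
        (window-source {Y} {X} (suc q) transfer) (window-target {Y} {X} (suc q) transfer)
        (window-elsewhere {Y} {X} (suc q) transfer) (subst (λ i → window X (suc q + r) + 2 ≤ window X i) (sym (+-identityʳ (suc q))) heavy)

    no-improving-right-move : ∀ q → x X q ≡ 1 → x X (suc q) ≡ 0 → ¬ Light X (suc q)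
    no-improving-right-move q xq≡1 xq+1≡0 light = contradiction (All.lookup local-max Y∈perturbations) (<⇒≱ improves)
      where
      u∈X = bit≡1⇒true xq≡1
      v∉X = bit≡0⇒false xq+1≡0
      Y = perturb X (toFin q) (toFin (suc q))
      Y∈perturbations : Y ∈ perturbations X
      Y∈perturbations = perturb∈perturbations X (here (sym (next-toFin q))) u∈X v∉X
      transfer = window-transfer {X} {Y} q (sym ∘ x-perturb {X} {q} {suc q} u∈X v∉X)
      improves : W X < W Y
      improves = transfer-improves {X} {Y} (suc q) r 0 (⌊n/2⌋<n (suc k)) (s≤s z≤n) r≢0 (∣perturb∣ {X = X} u∈X v∉X)
        (sym (window-target {X} {Y} (suc q) transfer)) (sym (window-source {X} {Y} (suc q) transfer))
        (λ j j<n j≢r j≢0 → sym (window-elsewhere {X} {Y} (suc q) transfer j j<n j≢0 j≢r))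
        (subst (λ i → window X i + 2 ≤ window X (suc q + r)) (sym (+-identityʳ (suc q))) light)

    windows-near-half : ∀ t → ⌊ ∣ X ∣ /2⌋ ≤ window X t × window X t ≤ suc ⌊ ∣ X ∣ /2⌋
    windows-near-half = subst (λ m → ∀ t → ⌊ m /2⌋ ≤ window X t × window X t ≤ suc ⌊ m /2⌋) (sym (∣X∣≡total X))
      (windows-balanced X (no-heavy-window X no-improving-left-move) (no-light-window X no-improving-right-move))

    -- Adding the size-dependent constant K turns cut m into cut c for the odd c = 2h + 1 ≥ m,
    -- which is at most h (h + 1) everywhere and equal to it exactly at h and h + 1.
    locally-maximal⇒maximal : ∀ Y → ∣ Y ∣ ≡ ∣ X ∣ → W Y ≤ W X
    locally-maximal⇒maximal Y ∣Y∣≡∣X∣ = m+m≤1+n+n⇒m≤n (m≤n⇒m≤1+n (+-cancelʳ-≤ K (W Y + W Y) (W X + W X) (begin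
      W Y + W Y + K                      ≡⟨ cong (λ m′ → W Y + W Y + (c ∸ m′) * (s * m′)) (sym ∣Y∣≡∣X∣) ⟩
      W Y + W Y + (c ∸ ∣ Y ∣) * (s * ∣ Y ∣) ≡⟨ W-cut-formula Y ∣Y∣≤c ⟩
      ∑[ t < n ] cut c (window Y t)      ≤⟨ ∑-mono-≤ n (λ t _ → cut-≤-half h (≤-trans (window≤∣X∣ Y t) ∣Y∣≤c)) ⟩
      ∑[ _ < n ] h * suc h               ≡⟨ sym (∑-cong n λ t _ → uncurry (cut-near-half h) (windows-near-half t)) ⟩
      ∑[ t < n ] cut c (window X t)      ≡⟨ sym (W-cut-formula X m≤c) ⟩
      W X + W X + K                      ∎)))
      where
      open ≤-Reasoning
      m = ∣ X ∣
      h = ⌊ m /2⌋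
      c = suc (h + h)
      K = (c ∸ m) * (s * m)
      m≤c : m ≤ c
      m≤c = n≤1+⌊n/2⌋+⌊n/2⌋ m
      ∣Y∣≤c : ∣ Y ∣ ≤ c
      ∣Y∣≤c = subst (_≤ c) (sym ∣Y∣≡∣X∣) m≤c

-- The hypothesis 2 ≤ ∣ A ∣ only serves to exclude the cycles with fewer than two vertices.
corollary4p5 : (n : ℕ) (A : Subset n) → 2 ≤ ∣ A ∣ →
    (∃ λ R → ALS W A R) ×
    (∀ R → ALS W A R → ∣ R ∣ ≡ ∣ A ∣ × (∀ (Y : Subset n) → ∣ Y ∣ ≡ ∣ A ∣ → W Y ≤ W R))
corollary4p5 zero          []      ()
corollary4p5 (suc zero)    A       2≤∣A∣ = contradiction (≤-trans 2≤∣A∣ (∣p∣≤n A)) λ { (s≤s ()) }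
corollary4p5 (suc (suc k)) A       _     = ALS-terminates W _ W≤N³ A , result-maximal
  where
  result-maximal : ∀ R → ALS W A R → ∣ R ∣ ≡ ∣ A ∣ × (∀ Y → ∣ Y ∣ ≡ ∣ A ∣ → W Y ≤ W R)
  result-maximal R run = ∣R∣≡∣A∣ , λ Y ∣Y∣≡∣A∣ →
    Cycle.locally-maximal⇒maximal k {R} (ALS-result-locally-maximal run) Y (trans ∣Y∣≡∣A∣ (sym ∣R∣≡∣A∣))
    where
    ∣R∣≡∣A∣ = ALS-preserves-∣∣ run
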